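{- Let $G=(V,E)$ be a graph and $x\in\mathrm{PM}(G)$ with $x_e>0$ for all $e\in E$. Let $S_1,\dots,S_m\subseteq V$ and let $W$ be an even walk in $G$. If $\chi_W\notin\Lambda^\perp(S_1,\dots,S_m)$, then there is at least one edge $e$ of $W$ and at least one index $i$ such that both endpoints of $e$ lie in $S_i$.
   Context: $\mathrm{PM}(G)$ is the perfect matching polytope of $G$ (convex hull of indicator vectors of perfect matchings). $\delta(T)$ is the set of edges with exactly one endpoint in $T$, $x(F)=\sum_{e\in F}x_e$. A tight odd set is $T\subseteq V$ with $|T|$ odd and $x(\delta(T))=1$. For $S\subseteq V$, $\Lambda(S)=\mathrm{span}\{\mathbf{1}_{\delta(T)}: T\subseteq S \text{ a tight odd set}\}\subseteq\mathbb{R}^E$, $\Lambda(S_1,\dots,S_m)=\Lambda(S_1)+\dots+\Lambda(S_m)$, and $\Lambda^\perp$ denotes its orthogonal complement in $\mathbb{R}^E$. An even walk is either a simple even cycle, or: two edge-disjoint odd cycles $C_1,C_2$ and a path $P$ (edge-disjoint from them, possibly empty) joining $v_1\in C_1$ to $v_2\in C_2$, traversed as $C_1$ from $v_1$, then $P$ to $v_2$, then $C_2$, then $P$ back to $v_1$. Writing it as the list of traversed edges $(e_1,\dots,e_k)$, $\chi_W=\sum_{i=1}^k(-1)^i\mathbf{1}_{e_i}$. -}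

module Defs where

open import Level using (Level; _⊔_) renaming (suc to lsuc)
open import Data.Nat using (ℕ; zero; suc; _%_; _≥_)
open import Data.Fin using (Fin; _≟_)
open import Data.Fin.Subset using (Subset; _∈_; _∉_; _⊆_; ∣_∣)
open import Data.Fin.Subset.Properties using (_∈?_)
open import Data.Product using (Σ; _×_; _,_; ∃)
open import Data.Sum using (_⊎_)
open import Data.List using (List; []; _∷_; length; _++_; reverse)
open import Data.List.Relation.Unary.All using (All)
open import Data.List.Relation.Unary.Unique.Propositional using (Unique)
open import Data.List.Relation.Binary.Disjoint.Propositional using (Disjoint)
open import Relation.Nullary using (¬_; yes; no)
open import Relation.Binary.PropositionalEquality using (_≡_; _≢_)
open import Algebra.Bundles using (CommutativeRing)
open import Relation.Binary.Structures using (IsStrictTotalOrder)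

record OrderedField (c ℓ : Level) : Set (lsuc (c ⊔ ℓ)) where
  field
    commRing : CommutativeRing c ℓ
  open CommutativeRing commRing public
  field
    _<_               : Carrier → Carrier → Set ℓ
    isStrictTotalOrder : IsStrictTotalOrder _≈_ _<_
    +-mono-<          : ∀ {a b} z → a < b → (a + z) < (b + z)
    *-pos             : ∀ {a b} → 0# < a → 0# < b → 0# < (a * b)
    0<1               : 0# < 1#
    inverse           : ∀ a → ¬ (a ≈ 0#) → Σ Carrier (λ b → (a * b) ≈ 1#)

  _≤_ : Carrier → Carrier → Set ℓ
  a ≤ b = (a < b) ⊎ (a ≈ b)

record Graph : Set where
  field
    n m    : ℕ
    src tgt : Fin m → Fin n
    loopless : ∀ e → src e ≢ tgt e
    simple   : ∀ e f → ((src e ≡ src f × tgt e ≡ tgt f) ⊎ (src e ≡ tgt f × tgt e ≡ src f)) → e ≡ f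

module _ (G : Graph) where
  open Graph G

  V E : Set
  V = Fin n
  E = Fin m

  Joins : E → V → V → Set
  Joins e u v = (src e ≡ u × tgt e ≡ v) ⊎ (src e ≡ v × tgt e ≡ u)

  data Walk : V → V → Set where
    []   : ∀ {v} → Walk v v
    step : ∀ {u v w} (e : E) → Joins e u v → Walk v w → Walk u w

  edges : ∀ {u v} → Walk u v → List E
  edges []           = []
  edges (step e _ p) = e ∷ edges p

  verts : ∀ {u v} → Walk u v → List V
  verts {u} []        = u ∷ []
  verts {u} (step e _ p) = u ∷ verts p

  initVerts : ∀ {u v} → Walk u v → List V
  initVerts []        = []
  initVerts {u} (step e _ p) = u ∷ initVerts p

  -- simple path: all vertices distinct (length 0 allowed)
  IsPath : ∀ {u v} → Walk u v → Set
  IsPath p = Unique (verts p)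

  IsCycle : ∀ {v} → Walk v v → Set
  IsCycle c = (length (edges c) ≥ 3) × Unique (initVerts c)

  EvenN OddN : ℕ → Set
  EvenN k = k % 2 ≡ 0
  OddN  k = k % 2 ≡ 1

  -- Even walks, indexed by their list of traversed edges (e₁,…,e_k).
  data EvenWalk : List E → Set where
    evenCycle : ∀ {v} (C : Walk v v) → IsCycle C → EvenN (length (edges C)) →
                EvenWalk (edges C)
    oddCycles : ∀ {v₁ v₂} (C₁ : Walk v₁ v₁) (P : Walk v₁ v₂) (C₂ : Walk v₂ v₂) →
                IsCycle C₁ → OddN (length (edges C₁)) →
                IsCycle C₂ → OddN (length (edges C₂)) →
                IsPath P →
                Disjoint (edges C₁) (edges C₂) →
                Disjoint (edges C₁) (edges P) →
                Disjoint (edges C₂) (edges P) →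
                EvenWalk (edges C₁ ++ edges P ++ edges C₂ ++ reverse (edges P))

  IsPerfectMatching : Subset m → Set
  IsPerfectMatching M =
    ∀ v → Σ E (λ e → e ∈ M × (src e ≡ v ⊎ tgt e ≡ v)) ×
          (∀ e f → e ∈ M → f ∈ M → (src e ≡ v ⊎ tgt e ≡ v) → (src f ≡ v ⊎ tgt f ≡ v) → e ≡ f)

  Inδ : Subset n → E → Set
  Inδ T e = (src e ∈ T × tgt e ∉ T) ⊎ (src e ∉ T × tgt e ∈ T)

  module _ {c ℓ} (F : OrderedField c ℓ) where
    open OrderedField F

    sumFin : ∀ {k} → (Fin k → Carrier) → Carrier
    sumFin {zero}  f = 0#
    sumFin {suc k} f = f Fin.zero + sumFin (λ i → f (Fin.suc i))

    sumList : ∀ {a} {A : Set a} → (A → Carrier) → List A → Carrier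
    sumList f []       = 0#
    sumList f (a ∷ as) = f a + sumList f as

    dot : (E → Carrier) → (E → Carrier) → Carrier
    dot y z = sumFin (λ e → y e * z e)

    𝟙 : Subset m → E → Carrier
    𝟙 M e with e ∈? M
    ... | yes _ = 1#
    ... | no  _ = 0#

    𝟙δ : Subset n → E → Carrier
    𝟙δ T e with src e ∈? T | tgt e ∈? T
    ... | yes _ | no _  = 1#
    ... | no _  | yes _ = 1#
    ... | _     | _     = 0#

    InPM : (E → Carrier) → Set (c ⊔ ℓ)
    InPM x = Σ (List (Carrier × Subset m)) λ L →
               All (λ { (λ' , M) → (0# ≤ λ') × IsPerfectMatching M }) L ×
               (sumList (λ { (λ' , M) → λ' }) L ≈ 1#) ×
               (∀ e → x e ≈ sumList (λ { (λ' , M) → λ' * 𝟙 M e }) L)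

    TightOdd : (E → Carrier) → Subset n → Set ℓ
    TightOdd x T = Lift' (∣ T ∣ % 2 ≡ 1) × (dot x (𝟙δ T) ≈ 1#)
      where
        open import Level using (Lift)
        Lift' : Set → Set ℓ
        Lift' A = Lift ℓ A

    InΛ : (E → Carrier) → ∀ {k} → (Fin k → Subset n) → (E → Carrier) → Set (c ⊔ ℓ)
    InΛ x {k} S y = Σ (List (Carrier × Fin k × Subset n)) λ L →
                      All (λ { (a , i , T) → (T ⊆ S i) × TightOdd x T }) L ×
                      (∀ e → y e ≈ sumList (λ { (a , i , T) → a * 𝟙δ T e }) L)

    InΛ⊥ : (E → Carrier) → ∀ {k} → (Fin k → Subset n) → (E → Carrier) → Set (c ⊔ ℓ)
    InΛ⊥ x S z = ∀ y → InΛ x S y → dot z y ≈ 0#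

    -- χ_W = Σ_i (-1)^i 1_{e_i}  (first edge gets sign -1)
    χgo : Carrier → List E → E → Carrier
    χgo s []       e = 0#
    χgo s (f ∷ fs) e with f ≟ e
    ... | yes _ = s  + χgo (- s) fs e
    ... | no  _ = 0# + χgo (- s) fs e

    χ : List E → E → Carrier
    χ W = χgo (- 1#) W

module Submission where

-- The argument is a telescoping sum.
--   * An even walk is the edge sequence of a closed walk of even length.
--   * ⟨χ_W, g⟩ is the alternating sum -g(e₁) + g(e₂) - … of g along W.
--   * If g(uv) = φ(u) + φ(v) on every edge of a closed walk of even
--     length, its alternating sum telescopes to 0.
--   * For an edge uv not inside T, 1_{δ(T)}(uv) = 1_T(u) + 1_T(v).
--   * Orthogonality to the generators passes to linear combinations.
-- Since "some edge of W lies inside some S_i" is decidable, the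
-- contrapositive yields the explicit edge and index.

open import Defs
open import Level using (Level)
open import Data.Nat as ℕ using (ℕ; _%_)
open import Data.Nat.DivMod using ([m+kn]%n≡m%n; %-distribˡ-+)
open import Data.Nat.Tactic.RingSolver using (solve-∀)
open import Data.Fin as Fin using (Fin; _≟_; punchIn)
open import Data.Fin.Properties using (punchInᵢ≢i) renaming (any? to any-index?)
open import Data.Fin.Subset using (Subset; _∈_; _⊆_)
open import Data.Fin.Subset.Properties using (_∈?_)
open import Data.Product using (Σ; _×_; _,_; proj₁; proj₂)
open import Data.Sum using (inj₁; inj₂)
open import Data.Empty using (⊥-elim)
open import Data.List using (List; []; _∷_; _++_; reverse; length; [_])
open import Data.List.Properties using (length-++; length-reverse; unfold-reverse)
open import Data.List.Relation.Unary.All as All using (All)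
open import Data.List.Relation.Unary.Any using (here; there; any?)
open import Data.List.Membership.Propositional using (find; lose)
  renaming (_∈_ to _∈ₗ_)
open import Data.Vec.Functional using (Vector)
open import Relation.Nullary using (¬_; yes; no)
open import Relation.Nullary.Decidable using (_×-dec_)
open import Relation.Unary using (Decidable)
open import Relation.Binary.PropositionalEquality as ≡ using (_≡_; _≢_)
open import Algebra.Properties.CommutativeSemigroup using (x∙yz≈y∙xz)
open import Algebra.Properties.Ring using (-‿involutive; -‿distribˡ-*; +-identityˡ-unique)
open import Algebra.Properties.Semiring.Sum
  using (sum; sum-cong-≋; sum-remove; sum-replicate-zero; ∑-distrib-+; *-distribˡ-sum)

-- Parity: a path traversed twice between two odd cycles gives an even
-- total length.
odd-cycles-path-even : ∀ a b c → a % 2 ≡ 1 → c % 2 ≡ 1 → (a ℕ.+ (b ℕ.+ (c ℕ.+ b))) % 2 ≡ 0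
odd-cycles-path-even a b c odd-a odd-c = begin
  (a ℕ.+ (b ℕ.+ (c ℕ.+ b))) % 2 ≡⟨ ≡.cong (_% 2) (regroup a b c) ⟩
  ((a ℕ.+ c) ℕ.+ b ℕ.* 2) % 2   ≡⟨ [m+kn]%n≡m%n (a ℕ.+ c) b 2 ⟩
  (a ℕ.+ c) % 2                  ≡⟨ %-distribˡ-+ a c 2 ⟩
  (a % 2 ℕ.+ c % 2) % 2          ≡⟨ ≡.cong₂ (λ p q → (p ℕ.+ q) % 2) odd-a odd-c ⟩
  0                              ∎
  where
  open ≡.≡-Reasoning
  regroup : ∀ a b c → a ℕ.+ (b ℕ.+ (c ℕ.+ b)) ≡ (a ℕ.+ c) ℕ.+ b ℕ.* 2
  regroup = solve-∀

module Walks (G : Graph) where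

  _++w_ : ∀ {u v w} → Walk G u v → Walk G v w → Walk G u w
  [] ++w q = q
  step e j p ++w q = step e j (p ++w q)

  edges-++w : ∀ {u v w} (p : Walk G u v) (q : Walk G v w) →
              edges G (p ++w q) ≡ edges G p ++ edges G q
  edges-++w [] q = ≡.refl
  edges-++w (step e j p) q = ≡.cong (e ∷_) (edges-++w p q)

  joins-sym : ∀ {e u v} → Joins G e u v → Joins G e v u
  joins-sym (inj₁ ends) = inj₂ ends
  joins-sym (inj₂ ends) = inj₁ ends

  reverseWalk : ∀ {u v} → Walk G u v → Walk G v u
  reverseWalk [] = []
  reverseWalk (step e j p) = reverseWalk p ++w step e (joins-sym j) []

  edges-reverseWalk : ∀ {u v} (p : Walk G u v) → edges G (reverseWalk p) ≡ reverse (edges G p)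
  edges-reverseWalk [] = ≡.refl
  edges-reverseWalk (step e j p) = begin
    edges G (reverseWalk p ++w step e (joins-sym j) []) ≡⟨ edges-++w (reverseWalk p) _ ⟩
    edges G (reverseWalk p) ++ [ e ]                    ≡⟨ ≡.cong (_++ [ e ]) (edges-reverseWalk p) ⟩
    reverse (edges G p) ++ [ e ]                        ≡⟨ unfold-reverse e (edges G p) ⟨
    reverse (e ∷ edges G p)                             ∎
    where open ≡.≡-Reasoning

  -- Every even walk is traced by a closed walk: C₁, then P, then C₂, then P back.
  evenWalk-closed : ∀ {W} → EvenWalk G W → Σ (V G) λ v → Σ (Walk G v v) λ p → edges G p ≡ W
  evenWalk-closed (evenCycle C _ _) = _ , C , ≡.refl
  evenWalk-closed (oddCycles C₁ P C₂ _ _ _ _ _ _ _ _) =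
    _ , (C₁ ++w (P ++w (C₂ ++w reverseWalk P))) , traced
    where
    open ≡.≡-Reasoning
    traced : edges G (C₁ ++w (P ++w (C₂ ++w reverseWalk P)))
           ≡ edges G C₁ ++ edges G P ++ edges G C₂ ++ reverse (edges G P)
    traced = begin
      edges G (C₁ ++w (P ++w (C₂ ++w reverseWalk P)))
        ≡⟨ edges-++w C₁ _ ⟩
      edges G C₁ ++ edges G (P ++w (C₂ ++w reverseWalk P))
        ≡⟨ ≡.cong (edges G C₁ ++_) (edges-++w P _) ⟩
      edges G C₁ ++ edges G P ++ edges G (C₂ ++w reverseWalk P)
        ≡⟨ ≡.cong (λ es → edges G C₁ ++ edges G P ++ es) (edges-++w C₂ _) ⟩
      edges G C₁ ++ edges G P ++ edges G C₂ ++ edges G (reverseWalk P)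
        ≡⟨ ≡.cong (λ es → edges G C₁ ++ edges G P ++ edges G C₂ ++ es) (edges-reverseWalk P) ⟩
      edges G C₁ ++ edges G P ++ edges G C₂ ++ reverse (edges G P) ∎

  evenWalk-even : ∀ {W} → EvenWalk G W → EvenN G (length W)
  evenWalk-even (evenCycle C _ even) = even
  evenWalk-even (oddCycles C₁ P C₂ _ odd₁ _ odd₂ _ _ _ _) =
    ≡.subst (λ k → k % 2 ≡ 0) (≡.sym total)
      (odd-cycles-path-even (length c₁) (length p) (length c₂) odd₁ odd₂)
    where
    open ≡.≡-Reasoning
    c₁ = edges G C₁
    p  = edges G P
    c₂ = edges G C₂
    total : length (c₁ ++ p ++ c₂ ++ reverse p)
          ≡ length c₁ ℕ.+ (length p ℕ.+ (length c₂ ℕ.+ length p))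
    total = begin
      length (c₁ ++ p ++ c₂ ++ reverse p)
        ≡⟨ length-++ c₁ ⟩
      length c₁ ℕ.+ length (p ++ c₂ ++ reverse p)
        ≡⟨ ≡.cong (length c₁ ℕ.+_) (length-++ p) ⟩
      length c₁ ℕ.+ (length p ℕ.+ length (c₂ ++ reverse p))
        ≡⟨ ≡.cong (λ l → length c₁ ℕ.+ (length p ℕ.+ l)) (length-++ c₂) ⟩
      length c₁ ℕ.+ (length p ℕ.+ (length c₂ ℕ.+ length (reverse p)))
        ≡⟨ ≡.cong (λ l → length c₁ ℕ.+ (length p ℕ.+ (length c₂ ℕ.+ l))) (length-reverse p) ⟩
      length c₁ ℕ.+ (length p ℕ.+ (length c₂ ℕ.+ length p)) ∎

module Orthogonality {c ℓ} (F : OrderedField c ℓ) (G : Graph) where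
  open OrderedField F
  open Graph G
  open Walks G
  open import Relation.Binary.Reasoning.Setoid setoid

  Σ[_] : (E G → Carrier) → Carrier
  Σ[_] = sum semiring

  sumFin≡sum : ∀ {k} (f : Fin k → Carrier) → sumFin G F f ≡ sum semiring f
  sumFin≡sum {ℕ.zero} f = ≡.refl
  sumFin≡sum {ℕ.suc k} f = ≡.cong (f Fin.zero +_) (sumFin≡sum (λ i → f (Fin.suc i)))

  dot≡sum : ∀ y z → dot G F y z ≡ Σ[ (λ e → y e * z e) ]
  dot≡sum y z = sumFin≡sum (λ e → y e * z e)

  dot-congʳ : ∀ y {z z′} → (∀ e → z e ≈ z′ e) → dot G F y z ≈ dot G F y z′
  dot-congʳ y {z} {z′} z≈z′ = begin
    dot G F y z              ≡⟨ dot≡sum y z ⟩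
    Σ[ (λ e → y e * z e) ]   ≈⟨ sum-cong-≋ semiring {m} (λ e → *-congˡ (z≈z′ e)) ⟩
    Σ[ (λ e → y e * z′ e) ]  ≡⟨ dot≡sum y z′ ⟨
    dot G F y z′             ∎

  dot-vanishing : ∀ y z → (∀ e → y e * z e ≈ 0#) → dot G F y z ≈ 0#
  dot-vanishing y z vanish = begin
    dot G F y z             ≡⟨ dot≡sum y z ⟩
    Σ[ (λ e → y e * z e) ]  ≈⟨ sum-cong-≋ semiring {m} vanish ⟩
    Σ[ (λ _ → 0#) ]         ≈⟨ sum-replicate-zero semiring m ⟩
    0#                      ∎

  sum-supported-at : ∀ {k} (t : Vector Carrier k) i →
                     (∀ j → j ≢ i → t j ≈ 0#) → sum semiring t ≈ t i
  sum-supported-at {ℕ.suc k} t i vanish = begin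
    sum semiring t                                ≈⟨ sum-remove semiring {i = i} t ⟩
    t i + sum semiring (λ j → t (punchIn i j))    ≈⟨ +-congˡ (sum-cong-≋ semiring (λ j → vanish _ (punchInᵢ≢i i j))) ⟩
    t i + sum semiring {k} (λ _ → 0#)             ≈⟨ +-congˡ (sum-replicate-zero semiring k) ⟩
    t i + 0#                                      ≈⟨ +-identityʳ _ ⟩
    t i                                           ∎

  altSum : Carrier → List (E G) → (E G → Carrier) → Carrier
  altSum s [] g = 0#
  altSum s (f ∷ fs) g = s * g f + altSum (- s) fs g

  headCoeff : Carrier → E G → E G → Carrier
  headCoeff s f e with f ≟ e
  ... | yes _ = s
  ... | no _ = 0#

  χgo-∷ : ∀ s f fs e → χgo G F s (f ∷ fs) e ≈ headCoeff s f e + χgo G F (- s) fs e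
  χgo-∷ s f fs e with f ≟ e
  ... | yes _ = refl
  ... | no _ = refl

  headCoeff-dot : ∀ s f (g : E G → Carrier) → Σ[ (λ e → headCoeff s f e * g e) ] ≈ s * g f
  headCoeff-dot s f g =
    trans (sum-supported-at (λ e → headCoeff s f e * g e) f vanish) (*-congʳ (at-f f ≡.refl))
    where
    vanish : ∀ e → e ≢ f → headCoeff s f e * g e ≈ 0#
    vanish e e≢f with f ≟ e
    ... | yes f≡e = ⊥-elim (e≢f (≡.sym f≡e))
    ... | no _ = zeroˡ (g e)
    at-f : ∀ e → f ≡ e → headCoeff s f e ≈ s
    at-f e f≡e with f ≟ e
    ... | yes _ = refl
    ... | no f≢e = ⊥-elim (f≢e f≡e)

  dot-χgo : ∀ s fs g → dot G F (χgo G F s fs) g ≈ altSum s fs g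
  dot-χgo s [] g = dot-vanishing _ g (λ e → zeroˡ (g e))
  dot-χgo s (f ∷ fs) g = begin
    dot G F (χgo G F s (f ∷ fs)) g
      ≡⟨ dot≡sum _ _ ⟩
    Σ[ (λ e → χgo G F s (f ∷ fs) e * g e) ]
      ≈⟨ sum-cong-≋ semiring {m} (λ e → trans (*-congʳ (χgo-∷ s f fs e)) (distribʳ (g e) _ _)) ⟩
    Σ[ (λ e → headCoeff s f e * g e + χgo G F (- s) fs e * g e) ]
      ≈⟨ ∑-distrib-+ semiring {m} _ _ ⟩
    Σ[ (λ e → headCoeff s f e * g e) ] + Σ[ (λ e → χgo G F (- s) fs e * g e) ]
      ≡⟨ ≡.cong (_ +_) (dot≡sum _ _) ⟨
    Σ[ (λ e → headCoeff s f e * g e) ] + dot G F (χgo G F (- s) fs) g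
      ≈⟨ +-cong (headCoeff-dot s f g) (dot-χgo (- s) fs g) ⟩
    s * g f + altSum (- s) fs g ∎

  alternate : ℕ → Carrier → Carrier
  alternate ℕ.zero s = s
  alternate (ℕ.suc k) s = alternate k (- s)

  alternate-even : ∀ k s → k % 2 ≡ 0 → alternate k s ≈ s
  alternate-even ℕ.zero s _ = refl
  alternate-even (ℕ.suc (ℕ.suc k)) s even = trans (alternate-even k (- - s) even) (-‿involutive ring s)

  Induced : (V G → Carrier) → (E G → Carrier) → E G → Set ℓ
  Induced φ g e = g e ≈ φ (src e) + φ (tgt e)

  induced-joins : ∀ {φ g e u v} → Joins G e u v → Induced φ g e → g e ≈ φ u + φ v
  induced-joins (inj₁ (≡.refl , ≡.refl)) induced = induced
  induced-joins (inj₂ (≡.refl , ≡.refl)) induced = trans induced (+-comm _ _)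

  telescope : ∀ φ g {u w} (p : Walk G u w) s → (∀ e → e ∈ₗ edges G p → Induced φ g e) →
              altSum s (edges G p) g + alternate (length (edges G p)) s * φ w ≈ s * φ u
  telescope φ g [] s _ = +-identityˡ _
  telescope φ g {u} {w} (step {v = v} e j p) s induced = begin
    (s * g e + altSum (- s) (edges G p) g) + alternate (length (edges G p)) (- s) * φ w
      ≈⟨ +-assoc _ _ _ ⟩
    s * g e + (altSum (- s) (edges G p) g + alternate (length (edges G p)) (- s) * φ w)
      ≈⟨ +-cong (*-congˡ (induced-joins {g = g} j (induced e (here ≡.refl))))
                (telescope φ g p (- s) (λ e′ e′∈p → induced e′ (there e′∈p))) ⟩
    s * (φ u + φ v) + (- s) * φ v
      ≈⟨ +-cong (distribˡ s _ _) (sym (-‿distribˡ-* ring s (φ v))) ⟩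
    (s * φ u + s * φ v) + - (s * φ v)
      ≈⟨ +-assoc _ _ _ ⟩
    s * φ u + (s * φ v + - (s * φ v))
      ≈⟨ +-congˡ (-‿inverseʳ _) ⟩
    s * φ u + 0#
      ≈⟨ +-identityʳ _ ⟩
    s * φ u ∎

  altSum-closed-even : ∀ φ g {v} (p : Walk G v v) s → EvenN G (length (edges G p)) →
                       (∀ e → e ∈ₗ edges G p → Induced φ g e) → altSum s (edges G p) g ≈ 0#
  altSum-closed-even φ g {v} p s even induced =
    +-identityˡ-unique ring _ (s * φ v)
      (trans (+-congˡ (*-congʳ (sym (alternate-even (length (edges G p)) s even))))
             (telescope φ g p s induced))

  indicator : Subset n → V G → Carrier
  indicator T v with v ∈? T
  ... | yes _ = 1#
  ... | no _ = 0#

  cut-induced : ∀ T e → ¬ (src e ∈ T × tgt e ∈ T) → Induced (indicator T) (𝟙δ G F T) e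
  cut-induced T e not-inside with src e ∈? T | tgt e ∈? T
  ... | yes s∈T | yes t∈T = ⊥-elim (not-inside (s∈T , t∈T))
  ... | yes _ | no _ = sym (+-identityʳ 1#)
  ... | no _ | yes _ = sym (+-identityˡ 1#)
  ... | no _ | no _ = sym (+-identityˡ 0#)

  χ-orthogonal-cut : ∀ {W} → EvenWalk G W → ∀ T →
                     (∀ e → e ∈ₗ W → ¬ (src e ∈ T × tgt e ∈ T)) → dot G F (χ G F W) (𝟙δ G F T) ≈ 0#
  χ-orthogonal-cut ew T not-inside with evenWalk-closed ew
  ... | v , p , ≡.refl =
    trans (dot-χgo (- 1#) (edges G p) (𝟙δ G F T))
      (altSum-closed-even (indicator T) (𝟙δ G F T) p (- 1#) (evenWalk-even ew)
        (λ e e∈p → cut-induced T e (not-inside e e∈p)))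

  orthogonal-combination : ∀ {a} {A : Set a} (z : E G → Carrier) (coeff : A → Carrier)
    (gen : A → E G → Carrier) (L : List A) → All (λ t → dot G F z (gen t) ≈ 0#) L →
    dot G F z (λ e → sumList G F (λ t → coeff t * gen t e) L) ≈ 0#
  orthogonal-combination z coeff gen [] All.[] = dot-vanishing z _ (λ e → zeroʳ (z e))
  orthogonal-combination z coeff gen (t ∷ L) (z⊥t All.∷ z⊥L) = begin
    dot G F z (λ e → coeff t * gen t e + rest e)
      ≡⟨ dot≡sum _ _ ⟩
    Σ[ (λ e → z e * (coeff t * gen t e + rest e)) ]
      ≈⟨ sum-cong-≋ semiring {m} (λ e → trans (distribˡ (z e) _ _)
                                                (+-congʳ (x∙yz≈y∙xz *-commutativeSemigroup (z e) _ _))) ⟩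
    Σ[ (λ e → coeff t * (z e * gen t e) + z e * rest e) ]
      ≈⟨ ∑-distrib-+ semiring {m} _ _ ⟩
    Σ[ (λ e → coeff t * (z e * gen t e)) ] + Σ[ (λ e → z e * rest e) ]
      ≈⟨ +-congʳ (sym (*-distribˡ-sum semiring {m} (coeff t) _)) ⟩
    coeff t * Σ[ (λ e → z e * gen t e) ] + Σ[ (λ e → z e * rest e) ]
      ≡⟨ ≡.cong₂ (λ a b → coeff t * a + b) (dot≡sum _ _) (dot≡sum _ _) ⟨
    coeff t * dot G F z (gen t) + dot G F z rest
      ≈⟨ +-cong (trans (*-congˡ z⊥t) (zeroʳ _)) (orthogonal-combination z coeff gen L z⊥L) ⟩
    0# + 0#
      ≈⟨ +-identityʳ 0# ⟩
    0# ∎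
    where
    rest : E G → Carrier
    rest e = sumList G F (λ t → coeff t * gen t e) L

  χ-in-Λ⊥ : ∀ x {k} (S : Fin k → Subset n) {W} → EvenWalk G W →
            (∀ e → e ∈ₗ W → ∀ i → ¬ (src e ∈ S i × tgt e ∈ S i)) → InΛ⊥ G F x S (χ G F W)
  χ-in-Λ⊥ x S {W} ew not-inside y (L , tight , y≈comb) =
    trans (dot-congʳ (χ G F W) y≈comb)
      (orthogonal-combination (χ G F W) proj₁ (λ t → 𝟙δ G F (proj₂ (proj₂ t))) L
        (All.map (λ { {_ , i , T} (T⊆Sᵢ , _) → orthogonal-generator i T T⊆Sᵢ }) tight))
    where
    orthogonal-generator : ∀ i T → T ⊆ S i → dot G F (χ G F W) (𝟙δ G F T) ≈ 0#
    orthogonal-generator i T T⊆Sᵢ = χ-orthogonal-cut ew T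
      (λ e e∈W (src∈T , tgt∈T) → not-inside e e∈W i (T⊆Sᵢ src∈T , T⊆Sᵢ tgt∈T))

inside-some? : (G : Graph) → ∀ {k} (S : Fin k → Subset (Graph.n G)) →
               Decidable (λ e → Σ (Fin k) λ i → (Graph.src G e ∈ S i) × (Graph.tgt G e ∈ S i))
inside-some? G S e = any-index? (λ i → (Graph.src G e ∈? S i) ×-dec (Graph.tgt G e ∈? S i))

-- Either some edge of W lies inside some S_i, or χ_W ∈ Λ^⊥ contradicts
-- the hypothesis.
lemma5p6 : ∀ {c ℓ : Level} (F : OrderedField c ℓ) (G : Graph) →
    let open OrderedField F in let open Graph G in
    (x : E G → Carrier) → InPM G F x → (∀ e → 0# < x e) →
    ∀ {k} (S : Fin k → Subset n) (W : List (E G)) → EvenWalk G W →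
    ¬ InΛ⊥ G F x S (χ G F W) →
    Σ (E G) λ e → (e ∈ₗ W) × Σ (Fin k) λ i → (src e ∈ S i) × (tgt e ∈ S i)
lemma5p6 F G x _ _ S W ew not-perp with any? (inside-some? G S) W
... | yes some-inside = find some-inside
... | no none-inside =
  ⊥-elim (not-perp (Orthogonality.χ-in-Λ⊥ F G x S ew
    (λ e e∈W i inside → none-inside (lose e∈W (i , inside)))))
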